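{- Let $G_0,G_1,\dots,G_m$ be a chain decomposition of a graph $G$ rooted at $r$, let $0\le i\le m$, and let $v\ne r$ be a vertex. If $v\in V(H_i)$ (respectively $v\in V(\overline{H_i})$), then $v$ is incident to a non-loop edge of $H_i$ (respectively $\overline{H_i}$). If $v$ has degree at least two in $H_i$ (respectively $\overline{H_i}$), then $v$ is incident to two distinct non-loop edges of $H_i$ (respectively $\overline{H_i}$).
   Context: Graphs are multigraphs (parallel edges and loops allowed; a loop adds $2$ to the degree; a loop is a cycle of length one and two parallel edges form a cycle of length two). Paths and cycles are simple. The degree of a vertex in a subgraph not containing it is $0$. An up chain of $G$ with respect to a pair of edge-disjoint subgraphs $(H,\overline{H})$ is a subgraph of $G$, edge-disjoint from $H$ and $\overline{H}$, which is either (i) a path with at least one edge such that every vertex is either $r$ or has degree at least two in $\overline{H}$, and each end is either $r$ or lies in $H$; or (ii) a cycle such that every vertex is either $r$ or has degree at least two in $\overline{H}$, and some vertex $v$ of it is either $r$ or has degree at least two in $H$ ($v$ is regarded as both ends, all other vertices internal). A down chain with respect to $(H,\overline{H})$ is an up chain with respect to $(\overline{H},H)$. A one-way chain with respect to $(H,\overline{H})$ is the subgraph induced by a single edge $e\notin E(H)\cup E(\overline{H})$ with ends $u$ (tail) and $v$ (head) such that $u$ is $r$ or has degree at least two in $H$, and $v$ is $r$ or has degree at least two in $\overline{H}$. A sequence $G_0,\dots,G_m$ of subgraphs of $G$ is a chain decomposition of $G$ rooted at $r\in V(G)$ if, writing $H_i=G_0\cup\cdots\cup G_{i-1}$ and $\overline{H_i}=G_{i+1}\cup\cdots\cup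 G_m$ (so $H_0$ and $\overline{H_m}$ are null), the sets $E(G_0),\dots,E(G_m)$ partition $E(G)$ and each $G_i$ is an up chain, a down chain, or a one-way chain with respect to $(H_i,\overline{H_i})$. -}

module Defs where

open import Data.Nat using (ℕ; zero; suc; _+_; _≤_; _<_; _<?_)
open import Data.Fin using (Fin; zero; suc; toℕ; inject₁; fromℕ; _≟_)
open import Data.Bool using (Bool; true; false; if_then_else_)
open import Data.Product using (Σ; ∃; ∃-syntax; _×_; _,_; proj₁; proj₂)
open import Data.Sum using (_⊎_)
open import Relation.Nullary using (¬_; does)
open import Relation.Binary.PropositionalEquality using (_≡_; _≢_)
open import Function.Definitions using (Injective)

-- A finite multigraph: vertices Fin n, edges Fin k, each edge has a pair of
-- ends (ends e = (a , b); a ≡ b means a loop).  Orientation of the pair is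
-- irrelevant: all notions below are symmetric in the two ends.
record Graph : Set where
  field
    nV   : ℕ
    nE   : ℕ
    ends : Fin nE → Fin nV × Fin nV
open Graph public

Vtx : Graph → Set
Vtx G = Fin (nV G)

Edge : Graph → Set
Edge G = Fin (nE G)

-- An (edge-)subgraph is given by its edge set (as a Boolean indicator);
-- its vertex set is the set of ends of its edges.  (All subgraphs in a chain
-- decomposition -- paths with ≥1 edge, cycles, single edges, and unions of
-- these -- have this form.)
ESet : Graph → Set
ESet G = Edge G → Bool

sumFin : ∀ {k} → (Fin k → ℕ) → ℕ
sumFin {zero}  f = 0
sumFin {suc k} f = f zero + sumFin (λ j → f (suc j))

-- number of ends of e equal to v (a loop at v contributes 2)
incid : (G : Graph) → Edge G → Vtx G → ℕ
incid G e v =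
  (if does (proj₁ (ends G e) ≟ v) then 1 else 0) +
  (if does (proj₂ (ends G e) ≟ v) then 1 else 0)

deg : (G : Graph) → ESet G → Vtx G → ℕ
deg G S v = sumFin (λ e → if S e then incid G e v else 0)

IsEnd : (G : Graph) → Vtx G → Edge G → Set
IsEnd G v e = proj₁ (ends G e) ≡ v ⊎ proj₂ (ends G e) ≡ v

IsLoop : (G : Graph) → Edge G → Set
IsLoop G e = proj₁ (ends G e) ≡ proj₂ (ends G e)

InV : (G : Graph) → ESet G → Vtx G → Set
InV G S v = ∃[ e ] (S e ≡ true × IsEnd G v e)

Joins : (G : Graph) → Edge G → Vtx G → Vtx G → Set
Joins G e a b = ends G e ≡ (a , b) ⊎ ends G e ≡ (b , a)

ExactlyEdges : (G : Graph) {ℓ : ℕ} → ESet G → (Fin ℓ → Edge G) → Set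
ExactlyEdges G C es = ∀ e → (C e ≡ true → ∃[ j ] es j ≡ e) × (∃[ j ] es j ≡ e → C e ≡ true)

RootOrDeg2 : (G : Graph) → Vtx G → ESet G → Vtx G → Set
RootOrDeg2 G r S v = v ≡ r ⊎ 2 ≤ deg G S v

Disjoint : (G : Graph) → ESet G → ESet G → Set
Disjoint G C S = ∀ e → C e ≡ true → S e ≡ false

-- Up chain of G with respect to (H , Hb), rooted at r, with edge set C.
-- (i) path v₀ e₀ v₁ … e_p v_{p+1} (p+1 ≥ 1 edges, distinct vertices, distinct edges)
-- (ii) cycle v₀ e₀ v₁ … v_p e_p v₀ (p+1 ≥ 1 edges, distinct vertices, distinct edges);
--      length one = loop, length two = two parallel edges.
data UpChain (G : Graph) (r : Vtx G) (H Hb C : ESet G) : Set where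
  path : (p : ℕ) (vs : Fin (suc (suc p)) → Vtx G) (es : Fin (suc p) → Edge G) →
         Injective _≡_ _≡_ vs → Injective _≡_ _≡_ es →
         (∀ j → Joins G (es j) (vs (inject₁ j)) (vs (suc j))) →
         ExactlyEdges G C es →
         (∀ j → RootOrDeg2 G r Hb (vs j)) →
         (vs zero ≡ r ⊎ InV G H (vs zero)) →
         (vs (fromℕ (suc p)) ≡ r ⊎ InV G H (vs (fromℕ (suc p)))) →
         UpChain G r H Hb C
  cycle : (p : ℕ) (vs : Fin (suc p) → Vtx G) (es : Fin (suc p) → Edge G) →
          Injective _≡_ _≡_ vs → Injective _≡_ _≡_ es →
          (∀ (j : Fin p) → Joins G (es (inject₁ j)) (vs (inject₁ j)) (vs (suc j))) →
          Joins G (es (fromℕ p)) (vs (fromℕ p)) (vs zero) →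
          ExactlyEdges G C es →
          (∀ j → RootOrDeg2 G r Hb (vs j)) →
          (∃[ j ] RootOrDeg2 G r H (vs j)) →
          UpChain G r H Hb C

data IsChain (G : Graph) (r : Vtx G) (H Hb C : ESet G) : Set where
  up      : Disjoint G C H → Disjoint G C Hb → UpChain G r H Hb C → IsChain G r H Hb C
  down    : Disjoint G C H → Disjoint G C Hb → UpChain G r Hb H C → IsChain G r H Hb C
  one-way : (e : Edge G) (u v : Vtx G) →
            H e ≡ false → Hb e ≡ false →
            (∀ f → C f ≡ true → f ≡ e) → C e ≡ true →
            ends G e ≡ (u , v) ⊎ ends G e ≡ (v , u) →
            RootOrDeg2 G r H u → RootOrDeg2 G r Hb v →
            IsChain G r H Hb C

-- A partition of E(G) into m+1 classes G₀,…,G_m is encoded by the map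
-- part : E(G) → Fin (suc m) sending each edge to the index of its class.
Gi : (G : Graph) {m : ℕ} → (Edge G → Fin (suc m)) → Fin (suc m) → ESet G
Gi G part i e = does (part e ≟ i)

Hi : (G : Graph) {m : ℕ} → (Edge G → Fin (suc m)) → Fin (suc m) → ESet G
Hi G part i e = does (toℕ (part e) <? toℕ i)

Hbi : (G : Graph) {m : ℕ} → (Edge G → Fin (suc m)) → Fin (suc m) → ESet G
Hbi G part i e = does (toℕ i <? toℕ (part e))

ChainDecomposition : (G : Graph) (r : Vtx G) (m : ℕ) → (Edge G → Fin (suc m)) → Set
ChainDecomposition G r m part =
  ∀ i → IsChain G r (Hi G part i) (Hbi G part i) (Gi G part i)

HasNonLoop : (G : Graph) → ESet G → Vtx G → Set
HasNonLoop G S v = ∃[ e ] (S e ≡ true × ¬ IsLoop G e × IsEnd G v e)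

HasTwoNonLoops : (G : Graph) → ESet G → Vtx G → Set
HasTwoNonLoops G S v =
  ∃[ e ] ∃[ f ] (e ≢ f × S e ≡ true × ¬ IsLoop G e × IsEnd G v e
                       × S f ≡ true × ¬ IsLoop G f × IsEnd G v f)

-- A loop at v ≠ r can only arise as a chain G_j that is a cycle of length one
-- (edges of paths and of longer cycles join distinct vertices, and a one-way
-- chain that is a loop has both its ends at v), so v has degree at least two
-- in H_j and in H̄_j.  For a loop of H_i we have j < i and H_j ⊆ H_i; for a
-- loop of H̄_i, j > i and H̄_j ⊆ H̄_i.  Since degree two at v is witnessed
-- either by a loop at v or by two distinct non-loop edges, well-founded
-- induction on the index pushes every loop down to two non-loop edges.
module Submission where

open import Defs
open import Data.Nat using (ℕ; zero; suc; _≤_; z≤n; s≤s; _<?_)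
open import Data.Nat.Properties using (1+n≢n)
open import Data.Fin using (Fin; zero; suc; toℕ; inject₁; fromℕ; _≟_; _<_; _>_)
open import Data.Fin.Properties using (suc-injective; toℕ-inject₁; <-trans; 0≢1+n)
open import Data.Fin.Induction using (<-wellFounded; >-wellFounded)
open import Data.Bool using (true; if_then_else_)
open import Data.Product using (∃-syntax; _×_; _,_; proj₁; proj₂; swap; map)
open import Data.Sum using (_⊎_; inj₁; inj₂)
open import Data.Empty using (⊥-elim)
open import Induction.WellFounded using (WellFounded; Acc; acc)
open import Relation.Binary.Core using (Rel)
open import Relation.Nullary using (Dec; yes; no; does; contradiction)
open import Relation.Nullary.Decidable using (dec-true)
open import Relation.Binary.PropositionalEquality using (_≡_; _≢_; refl; sym; trans; cong; subst)

does-true⇒ : ∀ {a} {A : Set a} (a? : Dec A) → does a? ≡ true → A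
does-true⇒ (yes a) _ = a
does-true⇒ (no _) ()

sumFin-≥1 : ∀ {k} (f : Fin k → ℕ) → 1 ≤ sumFin f → ∃[ j ] 1 ≤ f j
sumFin-≥1 {zero}  f ()
sumFin-≥1 {suc k} f h with f zero in eq
... | zero  = let j , p = sumFin-≥1 (λ j → f (suc j)) h in suc j , p
... | suc _ = zero , subst (1 ≤_) (sym eq) (s≤s z≤n)

sumFin-≥2 : ∀ {k} (f : Fin k → ℕ) → 2 ≤ sumFin f →
  (∃[ j ] 2 ≤ f j) ⊎ (∃[ j ] ∃[ j′ ] (j ≢ j′ × 1 ≤ f j × 1 ≤ f j′))
sumFin-≥2 {zero}  f ()
sumFin-≥2 {suc k} f h with f zero in eq
sumFin-≥2 {suc k} f h | zero with sumFin-≥2 (λ j → f (suc j)) h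
... | inj₁ (j , p)             = inj₁ (suc j , p)
... | inj₂ (j , j′ , j≢j′ , p , p′) =
  inj₂ (suc j , suc j′ , (λ e → j≢j′ (suc-injective e)) , p , p′)
sumFin-≥2 {suc k} f (s≤s h) | suc zero =
  let j , p = sumFin-≥1 (λ j → f (suc j)) h
  in inj₂ (zero , suc j , (λ ()) , subst (1 ≤_) (sym eq) (s≤s z≤n) , p)
sumFin-≥2 {suc k} f h | suc (suc _) = inj₁ (zero , subst (2 ≤_) (sym eq) (s≤s (s≤s z≤n)))

inject₁≢suc : ∀ {n} (j : Fin n) → inject₁ j ≢ suc j
inject₁≢suc j eq = 1+n≢n (trans (sym (cong toℕ eq)) (toℕ-inject₁ j))

inject₁-or-fromℕ : ∀ {n} (j : Fin (suc n)) → (∃[ j′ ] inject₁ j′ ≡ j) ⊎ j ≡ fromℕ n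
inject₁-or-fromℕ {zero}  zero    = inj₂ refl
inject₁-or-fromℕ {suc n} zero    = inj₁ (zero , refl)
inject₁-or-fromℕ {suc n} (suc j) with inject₁-or-fromℕ j
... | inj₁ (j′ , eq) = inj₁ (suc j′ , cong suc eq)
... | inj₂ eq        = inj₂ (cong suc eq)

module _ (G : Graph) where

  _⊆_ : ESet G → ESet G → Set
  S ⊆ T = ∀ {e} → S e ≡ true → T e ≡ true

  LoopAt : Vtx G → Edge G → Set
  LoopAt v e = proj₁ (ends G e) ≡ v × proj₂ (ends G e) ≡ v

  HasNonLoop-mono : ∀ {S T v} → S ⊆ T → HasNonLoop G S v → HasNonLoop G T v
  HasNonLoop-mono S⊆T (e , e∈S , nl , end) = e , S⊆T e∈S , nl , end

  HasTwoNonLoops-mono : ∀ {S T v} → S ⊆ T → HasTwoNonLoops G S v → HasTwoNonLoops G T v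
  HasTwoNonLoops-mono S⊆T (e , f , e≢f , e∈S , nl , end , f∈S , nl′ , end′) =
    e , f , e≢f , S⊆T e∈S , nl , end , S⊆T f∈S , nl′ , end′

  HasTwoNonLoops⇒HasNonLoop : ∀ {S v} → HasTwoNonLoops G S v → HasNonLoop G S v
  HasTwoNonLoops⇒HasNonLoop (e , _ , _ , e∈S , nl , end , _) = e , e∈S , nl , end

  IsEnd∧IsLoop⇒LoopAt : ∀ {v e} → IsEnd G v e → IsLoop G e → LoopAt v e
  IsEnd∧IsLoop⇒LoopAt (inj₁ p) l = p , trans (sym l) p
  IsEnd∧IsLoop⇒LoopAt (inj₂ q) l = trans l q , q

  Joins-LoopAt : ∀ {e a b v} → Joins G e a b → LoopAt v e → a ≡ v × b ≡ v
  Joins-LoopAt (inj₁ refl) (p , q) = p , q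
  Joins-LoopAt (inj₂ refl) (p , q) = q , p

  Joins-LoopAt⇒≡ : ∀ {e a b v} → Joins G e a b → LoopAt v e → a ≡ b
  Joins-LoopAt⇒≡ j l = let a≡v , b≡v = Joins-LoopAt j l in trans a≡v (sym b≡v)

  incid-≥1 : ∀ {e v} → 1 ≤ incid G e v → IsEnd G v e
  incid-≥1 {e} {v} h with proj₁ (ends G e) ≟ v | proj₂ (ends G e) ≟ v
  ... | yes p | _     = inj₁ p
  ... | no _  | yes q = inj₂ q
  incid-≥1 () | no _ | no _

  incid-≥2 : ∀ {e v} → 2 ≤ incid G e v → LoopAt v e
  incid-≥2 {e} {v} h with proj₁ (ends G e) ≟ v | proj₂ (ends G e) ≟ v
  ... | yes p | yes q = p , q
  incid-≥2 (s≤s ()) | yes _ | no _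
  incid-≥2 (s≤s ()) | no _  | yes _
  incid-≥2 ()       | no _  | no _

  degTerm-≥1 : ∀ {S : ESet G} {e v} → 1 ≤ (if S e then incid G e v else 0) → S e ≡ true × IsEnd G v e
  degTerm-≥1 {S} {e} h with S e
  ... | true = refl , incid-≥1 h

  degTerm-≥2 : ∀ {S : ESet G} {e v} → 2 ≤ (if S e then incid G e v else 0) → S e ≡ true × LoopAt v e
  degTerm-≥2 {S} {e} h with S e
  ... | true = refl , incid-≥2 h

  deg-≥2⇒loop⊎HasTwoNonLoops : ∀ {S v} → 2 ≤ deg G S v →
    (∃[ e ] (S e ≡ true × LoopAt v e)) ⊎ HasTwoNonLoops G S v
  deg-≥2⇒loop⊎HasTwoNonLoops {S} {v} h with sumFin-≥2 (λ e → if S e then incid G e v else 0) h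
  ... | inj₁ (e , p) = inj₁ (e , degTerm-≥2 {S} p)
  ... | inj₂ (e , f , e≢f , p , q)
    with degTerm-≥1 {S} p | degTerm-≥1 {S} q
       | proj₁ (ends G e) ≟ proj₂ (ends G e) | proj₁ (ends G f) ≟ proj₂ (ends G f)
  ... | e∈S , end | _ | yes l | _ = inj₁ (e , e∈S , IsEnd∧IsLoop⇒LoopAt end l)
  ... | _ | f∈S , end′ | no _ | yes l = inj₁ (f , f∈S , IsEnd∧IsLoop⇒LoopAt end′ l)
  ... | e∈S , end | f∈S , end′ | no nl | no nl′ =
    inj₂ (e , f , e≢f , e∈S , nl , end , f∈S , nl′ , end′)

  UpChain-LoopAt⇒RootOrDeg2 : ∀ {r H Hb C e v} → UpChain G r H Hb C → C e ≡ true → LoopAt v e →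
    RootOrDeg2 G r H v × RootOrDeg2 G r Hb v
  UpChain-LoopAt⇒RootOrDeg2 (path _ vs _ vs-inj _ joins edges _ _ _) e∈C loop
    with j , refl ← proj₁ (edges _) e∈C
    = ⊥-elim (inject₁≢suc j (vs-inj (Joins-LoopAt⇒≡ (joins j) loop)))
  UpChain-LoopAt⇒RootOrDeg2 {r} {H} {Hb} (cycle zero vs _ _ _ _ closing edges deg-Hb (zero , deg-H)) e∈C loop
    with zero , refl ← proj₁ (edges _) e∈C
    = let vs₀≡v , _ = Joins-LoopAt closing loop
      in subst (RootOrDeg2 G r H) vs₀≡v deg-H , subst (RootOrDeg2 G r Hb) vs₀≡v (deg-Hb zero)
  UpChain-LoopAt⇒RootOrDeg2 (cycle (suc _) vs _ vs-inj _ joins closing edges _ _) e∈C loop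
    with j , refl ← proj₁ (edges _) e∈C
    with inject₁-or-fromℕ j
  ... | inj₁ (j′ , refl) = ⊥-elim (inject₁≢suc j′ (vs-inj (Joins-LoopAt⇒≡ (joins j′) loop)))
  ... | inj₂ refl        = ⊥-elim (0≢1+n (sym (vs-inj (Joins-LoopAt⇒≡ closing loop))))

  IsChain-LoopAt⇒RootOrDeg2 : ∀ {r H Hb C e v} → IsChain G r H Hb C → C e ≡ true → LoopAt v e →
    RootOrDeg2 G r H v × RootOrDeg2 G r Hb v
  IsChain-LoopAt⇒RootOrDeg2 (up _ _ chain)   e∈C loop = UpChain-LoopAt⇒RootOrDeg2 chain e∈C loop
  IsChain-LoopAt⇒RootOrDeg2 (down _ _ chain) e∈C loop = swap (UpChain-LoopAt⇒RootOrDeg2 chain e∈C loop)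
  IsChain-LoopAt⇒RootOrDeg2 {r} {H} {Hb} (one-way _ u w _ _ only _ joins deg-u deg-w) e∈C loop
    with refl ← only _ e∈C
    = let u≡v , w≡v = Joins-LoopAt joins loop
      in subst (RootOrDeg2 G r H) u≡v deg-u , subst (RootOrDeg2 G r Hb) w≡v deg-w

  RootOrDeg2⇒deg-≥2 : ∀ {r S v} → v ≢ r → RootOrDeg2 G r S v → 2 ≤ deg G S v
  RootOrDeg2⇒deg-≥2 v≢r (inj₁ v≡r) = contradiction v≡r v≢r
  RootOrDeg2⇒deg-≥2 v≢r (inj₂ d)   = d

  module LoopDescent {v : Vtx G} {I : Set} {ℓ} {_≺_ : Rel I ℓ} (wf : WellFounded _≺_)
    (S : I → ESet G)
    (descend : ∀ {k e} → S k e ≡ true → LoopAt v e →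
               ∃[ k′ ] (k′ ≺ k × S k′ ⊆ S k × 2 ≤ deg G (S k′) v)) where

    deg-≥2⇒HasTwoNonLoops : ∀ k → 2 ≤ deg G (S k) v → HasTwoNonLoops G (S k) v
    deg-≥2⇒HasTwoNonLoops k = go (wf k)
      where
      go : ∀ {k} → Acc _≺_ k → 2 ≤ deg G (S k) v → HasTwoNonLoops G (S k) v
      go {k} (acc rs) d with deg-≥2⇒loop⊎HasTwoNonLoops {S k} d
      ... | inj₂ two = two
      ... | inj₁ (_ , e∈S , loop) =
        let _ , k′≺k , S′⊆S , d′ = descend e∈S loop
        in HasTwoNonLoops-mono S′⊆S (go (rs k′≺k) d′)

    InV⇒HasNonLoop : ∀ k → InV G (S k) v → HasNonLoop G (S k) v
    InV⇒HasNonLoop k (e , e∈S , end) with proj₁ (ends G e) ≟ proj₂ (ends G e)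
    ... | no nl = e , e∈S , nl , end
    ... | yes l =
      let k′ , _ , S′⊆S , d′ = descend e∈S (IsEnd∧IsLoop⇒LoopAt end l)
      in HasNonLoop-mono S′⊆S (HasTwoNonLoops⇒HasNonLoop (deg-≥2⇒HasTwoNonLoops k′ d′))

  module _ {m} (part : Edge G → Fin (suc m)) where

    ∈Hi⇒< : ∀ {i e} → Hi G part i e ≡ true → part e < i
    ∈Hi⇒< {i} {e} = does-true⇒ (toℕ (part e) <? toℕ i)

    ∈Hbi⇒> : ∀ {i e} → Hbi G part i e ≡ true → part e > i
    ∈Hbi⇒> {i} {e} = does-true⇒ (toℕ i <? toℕ (part e))

    Hi-mono : ∀ {i j} → j < i → Hi G part j ⊆ Hi G part i
    Hi-mono {i} j<i {f} f∈Hj = dec-true (toℕ (part f) <? toℕ i) (<-trans (∈Hi⇒< f∈Hj) j<i)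

    Hbi-antimono : ∀ {i j} → j > i → Hbi G part j ⊆ Hbi G part i
    Hbi-antimono {i} j>i {f} f∈Hbj = dec-true (toℕ i <? toℕ (part f)) (<-trans j>i (∈Hbi⇒> f∈Hbj))

    ∈Gi : ∀ e → Gi G part (part e) e ≡ true
    ∈Gi e = dec-true (part e ≟ part e) refl

  module Decomposition {r m} {part : Edge G → Fin (suc m)} (decomp : ChainDecomposition G r m part)
                       {v} (v≢r : v ≢ r) where

    LoopAt⇒deg-≥2 : ∀ {e} → LoopAt v e →
      2 ≤ deg G (Hi G part (part e)) v × 2 ≤ deg G (Hbi G part (part e)) v
    LoopAt⇒deg-≥2 {e} loop =
      map (RootOrDeg2⇒deg-≥2 v≢r) (RootOrDeg2⇒deg-≥2 v≢r)
          (IsChain-LoopAt⇒RootOrDeg2 (decomp (part e)) (∈Gi part e) loop)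

    loop-below : ∀ {i e} → Hi G part i e ≡ true → LoopAt v e →
      ∃[ j ] (j < i × Hi G part j ⊆ Hi G part i × 2 ≤ deg G (Hi G part j) v)
    loop-below {i} {e} e∈Hi loop =
      part e , e<i , Hi-mono part e<i , proj₁ (LoopAt⇒deg-≥2 loop)
      where e<i = ∈Hi⇒< part {i} e∈Hi

    loop-above : ∀ {i e} → Hbi G part i e ≡ true → LoopAt v e →
      ∃[ j ] (j > i × Hbi G part j ⊆ Hbi G part i × 2 ≤ deg G (Hbi G part j) v)
    loop-above {i} {e} e∈Hbi loop =
      part e , e>i , Hbi-antimono part e>i , proj₂ (LoopAt⇒deg-≥2 loop)
      where e>i = ∈Hbi⇒> part {i} e∈Hbi

    module Below = LoopDescent <-wellFounded (Hi G part) loop-below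
    module Above = LoopDescent >-wellFounded (Hbi G part) loop-above

lemma6 : (G : Graph) (r : Vtx G) (m : ℕ) (part : Edge G → Fin (suc m)) →
    ChainDecomposition G r m part →
    (i : Fin (suc m)) (v : Vtx G) → v ≢ r →
    (InV G (Hi G part i) v → HasNonLoop G (Hi G part i) v) ×
    (InV G (Hbi G part i) v → HasNonLoop G (Hbi G part i) v) ×
    (2 ≤ deg G (Hi G part i) v → HasTwoNonLoops G (Hi G part i) v) ×
    (2 ≤ deg G (Hbi G part i) v → HasTwoNonLoops G (Hbi G part i) v)
lemma6 G r m part decomp i v v≢r =
  Below.InV⇒HasNonLoop i , Above.InV⇒HasNonLoop i ,
  Below.deg-≥2⇒HasTwoNonLoops i , Above.deg-≥2⇒HasTwoNonLoops i
  where open Decomposition G decomp v≢r
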